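{- Let $n\geq 1$ be an integer and let $k=p2^{q}$, where $p$ is an odd positive integer and $q$ is a positive integer. Let $G$ be a complete balanced $k$-partite graph with $n$ vertices in each part. If $t$ is an integer with $(k-1)n\leq t\leq (2k-p-q)n-1$, then $G$ has an interval $t$-coloring.
   Context: All graphs are finite, undirected, without loops or multiple edges. A complete $k$-partite graph is a graph whose vertex set is partitioned into $k$ independent sets $V_1,\ldots,V_k$ such that every vertex of $V_i$ is adjacent to every vertex of $V_j$ for all $i\neq j$; it is balanced if $|V_1|=\cdots=|V_k|$. An edge-coloring of a graph $G$ with colors $1,\ldots,t$ is an interval $t$-coloring if every color $1,\ldots,t$ is used on at least one edge, and for each vertex the colors of the edges incident to it are pairwise distinct and form a set of consecutive integers. -}

module Defs where

open import Data.Nat using (ℕ; _≤_; _*_; _^_)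
open import Data.Fin using (Fin)
open import Data.Product using (Σ; _×_; ∃; _,_)
open import Data.Sum using (_⊎_)
open import Relation.Nullary using (¬_)
open import Relation.Binary.PropositionalEquality using (_≡_)
open import Level using (0ℓ; suc)

record GraphOn (Vtx : Set) : Set₁ where
  field
    Adj    : Vtx → Vtx → Set
    sym    : ∀ {u v} → Adj u v → Adj v u
    irrefl : ∀ {v} → ¬ Adj v v

completeBalancedMultipartite : (k n : ℕ) → GraphOn (Fin k × Fin n)
completeBalancedMultipartite k n = record
  { Adj    = λ { (i , a) (j , b) → ¬ (i ≡ j) }
  ; sym    = λ { ne eq → ne (Relation.Binary.PropositionalEquality.sym eq) }
  ; irrefl = λ { ne → ne Relation.Binary.PropositionalEquality.refl }
  }

-- An edge-colouring is a function on ordered vertex pairs; only its values on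
-- adjacent pairs matter, and we require symmetry so each edge gets one colour.
record IsIntervalColoring {Vtx : Set} (G : GraphOn Vtx) (t : ℕ)
         (c : Vtx → Vtx → ℕ) : Set where
  open GraphOn G
  field
    symmetric : ∀ u v (e : Adj u v) → c v u ≡ c u v
    inRange   : ∀ u v (e : Adj u v) → 1 ≤ c u v × c u v ≤ t
    allUsed   : ∀ x → 1 ≤ x → x ≤ t → Σ Vtx λ u → Σ Vtx λ v → Σ (Adj u v) λ e → c u v ≡ x
    proper    : ∀ u v w (e : Adj u v) (e' : Adj u w) → c u v ≡ c u w → v ≡ w
    interval  : ∀ u → (∀ v → ¬ Adj u v) ⊎ Σ ℕ λ lo → Σ ℕ λ hi →
                  ∀ x → ((lo ≤ x × x ≤ hi) → Σ Vtx λ v → Σ (Adj u v) λ e → c u v ≡ x)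
                      × ((Σ Vtx λ v → Σ (Adj u v) λ e → c u v ≡ x) → lo ≤ x × x ≤ hi)

HasIntervalColoring : {Vtx : Set} → GraphOn Vtx → ℕ → Set
HasIntervalColoring {Vtx} G t =
  Σ (Vtx → Vtx → ℕ) λ c → IsIntervalColoring G t c

-- The proof combines:
--  (1) K_{n,n}: for s < n the "wrapped addition table" (a,b) ↦ a+b, reduced
--      by n once it reaches n + s, uses the colours 0,…,n+s-1 and gives
--      vertex a the window of n consecutive colours from min(a,s) on;
--  (2) blow-up: replacing every vertex of an interval T-coloured K_k by n
--      vertices and every edge of colour c by a copy of (1) shifted by
--      n·(c-1) gives an interval (nT+s)-colouring of K_{k×n};
--  (3) a cyclic construction: K_{2M} has interval T-colourings for
--      2M-1 ≤ T ≤ 3M-2;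
--  (4) doubling: an interval T-colouring of K_m yields an interval
--      (T+2m-1)-colouring of K_{2m}.
-- Induction on q, with (3) as base case and (3)/(4) in the step, colours
-- K_k for every k-1 ≤ T ≤ 2k-P-q-1; writing t = nT + s with s < n and
-- applying (2) proves the corollary.
module Submission where

open import Defs
open import Data.Nat
open import Data.Nat.Properties
open import Data.Nat.DivMod using (_/_; _%_; m≡m%n+[m/n]*n; m%n<n; m<n*o⇒m/o<n; m*n/n≡m; /-monoˡ-≤)
open import Data.Nat.Tactic.RingSolver using (solve-∀)
open import Data.Bool using (Bool; true; false; if_then_else_)
open import Data.Fin using (Fin; toℕ; fromℕ<)
open import Data.Fin.Properties using (toℕ-injective; toℕ-fromℕ<; toℕ<n)
open import Data.Product
open import Data.Sum using (_⊎_; inj₁; inj₂)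
open import Data.Empty using (⊥-elim)
open import Relation.Nullary
open import Relation.Nullary.Decidable using (dec-true; dec-false)
open import Relation.Binary.Definitions using (tri<; tri≈; tri>)
open import Relation.Binary.PropositionalEquality

-- A difference witness for m ≤ n, oriented for rewriting n away.
≤⇒∃+ : ∀ {m n} → m ≤ n → Σ ℕ λ k → n ≡ m + k
≤⇒∃+ m≤n = let (k , eq) = m≤n⇒∃[o]m+o≡n m≤n in k , sym eq

≥1⇒suc : ∀ {x} → 1 ≤ x → Σ ℕ λ x' → x ≡ suc x'
≥1⇒suc {suc x} _ = x , refl

block-order : ∀ n {x y δ δ'} → δ < n → x < y → n * x + δ < n * y + δ'
block-order n {x} {y} {δ} {δ'} δ<n x<y = begin-strict
  n * x + δ    <⟨ +-monoʳ-< (n * x) δ<n ⟩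
  n * x + n    ≡⟨ trans (+-comm (n * x) n) (sym (*-suc n x)) ⟩
  n * suc x    ≤⟨ *-monoʳ-≤ n x<y ⟩
  n * y        ≤⟨ m≤m+n (n * y) δ' ⟩
  n * y + δ'   ∎
  where open ≤-Reasoning

divMod-unique : ∀ n {x y δ δ'} → δ < n → δ' < n → n * x + δ ≡ n * y + δ' → x ≡ y × δ ≡ δ'
divMod-unique n {x} {y} {δ} {δ'} δ<n δ'<n eq with <-cmp x y
... | tri< x<y _ _ = ⊥-elim (<⇒≢ (block-order n δ<n x<y) eq)
... | tri≈ _ refl _ = refl , +-cancelˡ-≡ (n * x) δ δ' eq
... | tri> _ _ y<x = ⊥-elim (<⇒≢ (block-order n δ'<n y<x) (sym eq))

wrap : ℕ → ℕ → ℕ → ℕ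
wrap x B n with x <? B
... | yes _ = x
... | no _  = x ∸ n

wrap-below : ∀ {x B} n → x < B → wrap x B n ≡ x
wrap-below {x} {B} n x<B with x <? B
... | yes _   = refl
... | no x≮B = ⊥-elim (x≮B x<B)

wrap-above : ∀ {x B} n → ¬ x < B → wrap x B n ≡ x ∸ n
wrap-above {x} {B} n x≮B with x <? B
... | yes x<B = ⊥-elim (x≮B x<B)
... | no _    = refl

wrap-cong : ∀ {x B B'} n → (x < B → x < B') → (x < B' → x < B) → wrap x B n ≡ wrap x B' n
wrap-cong {x} {B} {B'} n to from with x <? B
... | yes x<B = sym (wrap-below n (to x<B))
... | no x≮B  = sym (wrap-above n (λ x<B' → x≮B (from x<B')))

module RotatedRow (n a g : ℕ) (g≤a : g ≤ a) (a<n : a < n) where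
  instance
    n-nonZero : NonZero n
    n-nonZero = >-nonZero (≤-trans (s≤s z≤n) a<n)

  row : ℕ → ℕ
  row b = wrap (a + b) (n + g) n

  row-window : ∀ {b} → b < n → g ≤ row b × row b < g + n
  row-window {b} b<n with a + b <? n + g
  ... | yes a+b<n+g = ≤-trans g≤a (m≤m+n a b) , subst (a + b <_) (+-comm n g) a+b<n+g
  ... | no a+b≮n+g = g≤a+b∸n , a+b∸n<g+n
    where
    g≤a+b∸n : g ≤ a + b ∸ n
    g≤a+b∸n = subst (_≤ a + b ∸ n) (m+n∸m≡n n g) (∸-monoˡ-≤ n (≮⇒≥ a+b≮n+g))
    a+b∸n<g+n : a + b ∸ n < g + n
    a+b∸n<g+n = ≤-trans (m<n+o⇒m∸n<o (a + b) n (+-mono-< a<n b<n)) (m≤n+m n g)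

  private
    n≤a+b : ∀ {b} → ¬ a + b < n + g → n ≤ a + b
    n≤a+b a+b≥ = ≤-trans (m≤m+n n g) (≮⇒≥ a+b≥)

    reduced-apart : ∀ {b b'} → ¬ a + b' < n + g → a + b ≡ a + b' ∸ n → b + n ≡ b'
    reduced-apart {b} {b'} a+b'≥ eq = +-cancelˡ-≡ a (b + n) b' (begin
      a + (b + n)     ≡⟨ +-assoc a b n ⟨
      a + b + n       ≡⟨ cong (_+ n) eq ⟩
      a + b' ∸ n + n  ≡⟨ m∸n+n≡m (n≤a+b a+b'≥) ⟩
      a + b'          ∎)
      where open ≡-Reasoning

  -- Same side of the threshold: cancel a (and n).  Different sides: the
  -- larger argument would be at least n.
  row-injective : ∀ {b b'} → b < n → b' < n → row b ≡ row b' → b ≡ b'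
  row-injective {b} {b'} b<n b'<n eq with a + b <? n + g | a + b' <? n + g
  ... | yes _  | yes _  = +-cancelˡ-≡ a b b' eq
  ... | no b≥  | no b'≥ = +-cancelˡ-≡ a b b' (begin
      a + b           ≡⟨ m∸n+n≡m (n≤a+b b≥) ⟨
      a + b ∸ n + n   ≡⟨ cong (_+ n) eq ⟩
      a + b' ∸ n + n  ≡⟨ m∸n+n≡m (n≤a+b b'≥) ⟩
      a + b'          ∎)
    where open ≡-Reasoning
  ... | yes _  | no b'≥ = ⊥-elim (<⇒≱ b'<n (subst (n ≤_) (reduced-apart b'≥ eq) (m≤n+m n b)))
  ... | no b≥  | yes _  = ⊥-elim (<⇒≱ b<n (subst (n ≤_) (reduced-apart b≥ (sym eq)) (m≤n+m n b')))

  -- Colours x ≥ a are hit without reduction (b = x - a), smaller ones with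
  -- reduction (b = x + n - a).
  row-onto : ∀ {x} → g ≤ x → x < g + n → Σ ℕ λ b → b < n × row b ≡ x
  row-onto {x} g≤x x<g+n with a ≤? x
  ... | yes a≤x = x ∸ a , m<n+o⇒m∸n<o x a (≤-trans x<g+n (+-monoˡ-≤ n g≤a)) ,
                  trans (cong (λ z → wrap z (n + g) n) (m+[n∸m]≡n a≤x))
                        (wrap-below n (subst (x <_) (+-comm g n) x<g+n))
  ... | no a≰x = x + n ∸ a , m<n+o⇒m∸n<o (x + n) a (+-monoˡ-< n (≰⇒> a≰x)) ,
                  trans (cong (λ z → wrap z (n + g) n) (m+[n∸m]≡n a≤x+n))
                        (trans (wrap-above n x+n≮n+g) (m+n∸n≡m x n))
    where
    a≤x+n : a ≤ x + n
    a≤x+n = ≤-trans (<⇒≤ a<n) (m≤n+m n x)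
    x+n≮n+g : ¬ x + n < n + g
    x+n≮n+g x+n<n+g = <⇒≱ x+n<n+g (subst (n + g ≤_) (+-comm n x) (+-monoʳ-≤ n g≤x))

-- The table is symmetric, and row a is the rotated row with
-- g = min(a,s), so vertex a sees exactly the window [min(a,s), min(a,s)+n).
module BipartiteColouring (n s : ℕ) (s<n : s < n) where
  colour : ℕ → ℕ → ℕ
  colour a b = wrap (a + b) (n + s) n

  start : ℕ → ℕ
  start a = a ⊓ s

  colour-sym : ∀ a b → colour a b ≡ colour b a
  colour-sym a b = cong (λ z → wrap z (n + s) n) (+-comm a b)

  -- For a ≤ s the thresholds n + s and n + a are never separated by a + b.
  colour≡row : ∀ {a b} (a<n : a < n) → b < n →
               colour a b ≡ RotatedRow.row n a (start a) (m⊓n≤m a s) a<n b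
  colour≡row {a} {b} a<n b<n with a ≤? s
  ... | yes a≤s = wrap-cong n (λ _ → subst (λ z → a + b < n + z) (sym (m≤n⇒m⊓n≡m a≤s)) a+b<n+a)
                              (λ _ → ≤-trans a+b<n+a (+-monoʳ-≤ n a≤s))
    where
    a+b<n+a : a + b < n + a
    a+b<n+a = subst (a + b <_) (+-comm a n) (+-monoʳ-< a b<n)
  ... | no a≰s = cong (λ z → wrap (a + b) (n + z) n) (sym (m≥n⇒m⊓n≡n (<⇒≤ (≰⇒> a≰s))))

  module _ {a : ℕ} (a<n : a < n) where
    open RotatedRow n a (start a) (m⊓n≤m a s) a<n

    window : ∀ {b} → b < n → start a ≤ colour a b × colour a b < start a + n
    window b<n rewrite colour≡row a<n b<n = row-window b<n

    injective : ∀ {b b'} → b < n → b' < n → colour a b ≡ colour a b' → b ≡ b'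
    injective b<n b'<n eq =
      row-injective b<n b'<n (trans (sym (colour≡row a<n b<n)) (trans eq (colour≡row a<n b'<n)))

    onto : ∀ {x} → start a ≤ x → x < start a + n → Σ ℕ λ b → b < n × colour a b ≡ x
    onto g≤x x<g+n with row-onto g≤x x<g+n
    ... | b , b<n , eq = b , b<n , trans (colour≡row a<n b<n) eq

  -- Colours below n occur in row 0, the others in row s.
  every-colour : ∀ {x} → x < n + s → Σ ℕ λ a → Σ ℕ λ b → a < n × b < n × colour a b ≡ x
  every-colour {x} x<n+s with x <? n
  ... | yes x<n = 0 , x , ≤-trans (s≤s z≤n) x<n , x<n , wrap-below n x<n+s
  ... | no x≮n with onto s<n s≤x x<s+n
    where
    s≤x : start s ≤ x
    s≤x = subst (_≤ x) (sym (⊓-idem s)) (≤-trans (<⇒≤ s<n) (≮⇒≥ x≮n))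
    x<s+n : x < start s + n
    x<s+n = subst (λ z → x < z + n) (sym (⊓-idem s)) (subst (x <_) (+-comm n s) x<n+s)
  ... | b , b<n , eq = s , b , s<n , b<n , eq

-- Colourings of complete graphs K_{d+2}, with vertices 0,…,d+1.
-- An interval T-colouring: a symmetric colouring in which the colours at each
-- vertex u are distinct and form exactly the window [start u, start u + d]
-- (u has d+1 neighbours), inside [1,T], and every colour 1,…,T occurs.
record CompleteColouring (d T : ℕ) : Set where
  field
    colour     : ℕ → ℕ → ℕ
    start      : ℕ → ℕ
    symmetric  : ∀ {u v} → u < suc (suc d) → v < suc (suc d) → u ≢ v → colour u v ≡ colour v u
    start-pos  : ∀ {u} → u < suc (suc d) → 1 ≤ start u
    window-top : ∀ {u} → u < suc (suc d) → start u + d ≤ T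
    window     : ∀ {u v} → u < suc (suc d) → v < suc (suc d) → u ≢ v →
                 start u ≤ colour u v × colour u v ≤ start u + d
    injective  : ∀ {u v w} → u < suc (suc d) → v < suc (suc d) → w < suc (suc d) →
                 u ≢ v → u ≢ w → colour u v ≡ colour u w → v ≡ w
    onto       : ∀ {u x} → u < suc (suc d) → start u ≤ x → x ≤ start u + d →
                 Σ ℕ λ v → v < suc (suc d) × u ≢ v × colour u v ≡ x
    all-used   : ∀ {x} → 1 ≤ x → x ≤ T →
                 Σ ℕ λ u → Σ ℕ λ v → u < suc (suc d) × v < suc (suc d) × u ≢ v × colour u v ≡ x

  -- Vertex 0 has a non-empty window inside [1,T].
  T-pos : 1 ≤ T
  T-pos = ≤-trans (start-pos {0} (s≤s z≤n)) (≤-trans (m≤m+n _ d) (window-top {0} (s≤s z≤n)))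

CompleteColouring-cong : ∀ {d d' T T'} → d ≡ d' → T ≡ T' → CompleteColouring d T → CompleteColouring d' T'
CompleteColouring-cong refl refl K = K

-- In the blow-up, colour number X of K_k and colour φ of K_{n,n} combine
-- into the "block colour" 1 + n·X + φ.  The next lemmas locate, separate
-- and decode block colours.

divide : ∀ n y B .{{_ : NonZero n}} → y < B * n → Σ ℕ λ Q → Σ ℕ λ R → Q < B × R < n × y ≡ n * Q + R
divide n y B y<Bn = y / n , y % n , m<n*o⇒m/o<n y<Bn , m%n<n y n ,
  trans (m≡m%n+[m/n]*n y n) (trans (+-comm (y % n) _) (cong (_+ y % n) (*-comm (y / n) n)))

block-window : ∀ n {L X d g φ} → L ≤ X → X ≤ L + d → g ≤ φ → φ < g + n →
               suc (n * L + g) ≤ suc (n * X + φ) × suc (n * X + φ) ≤ n * (suc L + d) + g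
block-window n {L} {X} {d} {g} {φ} L≤X X≤L+d g≤φ φ<g+n =
  s≤s (+-mono-≤ (*-monoʳ-≤ n L≤X) g≤φ) , (begin
    suc (n * X + φ)    ≡⟨ +-suc (n * X) φ ⟨
    n * X + suc φ      ≤⟨ +-monoʳ-≤ (n * X) φ<g+n ⟩
    n * X + (g + n)    ≡⟨ regroup n X g ⟩
    n * suc X + g      ≤⟨ +-monoˡ-≤ g (*-monoʳ-≤ n (s≤s X≤L+d)) ⟩
    n * (suc L + d) + g ∎)
  where
  open ≤-Reasoning
  regroup : ∀ n X g → n * X + (g + n) ≡ n * suc X + g
  regroup = solve-∀

block-injective : ∀ n {X X' g φ φ'} → g ≤ φ → φ < g + n → g ≤ φ' → φ' < g + n →
                  n * X + φ ≡ n * X' + φ' → X ≡ X' × φ ≡ φ'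
block-injective n {X} {X'} {g} g≤φ φ<g+n g≤φ' φ'<g+n eq
  with ≤⇒∃+ g≤φ | ≤⇒∃+ g≤φ'
... | δ , refl | δ' , refl with divMod-unique n (+-cancelˡ-< g _ _ φ<g+n) (+-cancelˡ-< g _ _ φ'<g+n) eq'
  where
  move : ∀ n X g δ → g + (n * X + δ) ≡ n * X + (g + δ)
  move = solve-∀
  eq' : n * X + δ ≡ n * X' + δ'
  eq' = +-cancelˡ-≡ g _ _ (trans (move n X g δ) (trans eq (sym (move n X' g δ'))))
... | X≡X' , δ≡δ' = X≡X' , cong (g +_) δ≡δ'

block-decode : ∀ n L d g x .{{_ : NonZero n}} → suc (n * L + g) ≤ x → x ≤ n * (suc L + d) + g →
               Σ ℕ λ Q → Σ ℕ λ R → Q ≤ d × R < n × x ≡ suc (n * (L + Q) + (g + R))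
block-decode n L d g x lo≤x x≤hi with ≤⇒∃+ lo≤x
... | y , refl with divide n y (suc d) y<[1+d]n
  where
  top : ∀ n L d g → n * (suc L + d) + g ≡ (n * L + g) + n * suc d
  top = solve-∀
  y<[1+d]n : y < suc d * n
  y<[1+d]n = subst (suc y ≤_) (*-comm n (suc d))
    (+-cancelˡ-≤ (n * L + g) _ _ (subst₂ _≤_ (sym (+-suc (n * L + g) y)) (top n L d g) x≤hi))
... | Q , R , Q<1+d , R<n , refl = Q , R , ≤-pred Q<1+d , R<n , regroup n L g Q R
  where
  regroup : ∀ n L g Q R → suc (n * L + g) + (n * Q + R) ≡ suc (n * (L + Q) + (g + R))
  regroup = solve-∀

-- Every colour 1 ≤ x ≤ n·T + s (T ≥ 1) is a block colour with quotient
-- below T and remainder below n + s: the last block absorbs the s extra colours.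
block-cover : ∀ n s T x .{{_ : NonZero n}} → 1 ≤ T → 1 ≤ x → x ≤ n * T + s →
              Σ ℕ λ Q → Σ ℕ λ R → Q < T × R < n + s × x ≡ suc (n * Q + R)
block-cover n s T (suc y) T≥1 _ x≤nT+s with y <? T * n
... | yes y<Tn with divide n y T y<Tn
...   | Q , R , Q<T , R<n , refl = Q , R , Q<T , ≤-trans R<n (m≤m+n n s) , refl
block-cover n s (suc T') (suc y) _ _ x≤nT+s | no y≮Tn with ≤⇒∃+ nT'≤y
  where
  nT'≤y : n * T' ≤ y
  nT'≤y = ≤-trans (*-monoʳ-≤ n (n≤1+n T')) (subst (_≤ y) (*-comm (suc T') n) (≮⇒≥ y≮Tn))
... | R , refl = T' , R , ≤-refl , R<n+s , refl
  where
  top : ∀ n T' s → n * suc T' + s ≡ n * T' + (n + s)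
  top = solve-∀
  R<n+s : R < n + s
  R<n+s = +-cancelˡ-≤ (n * T') _ _ (subst₂ _≤_ (sym (+-suc (n * T') R)) (top n T' s) x≤nT+s)

toFin : ∀ {m} v → v < m → Σ (Fin m) λ j → toℕ j ≡ v
toFin v v<m = fromℕ< v<m , toℕ-fromℕ< v<m

toℕ-≢ : ∀ {m} {i j : Fin m} → ¬ i ≡ j → toℕ i ≢ toℕ j
toℕ-≢ i≢j eq = i≢j (toℕ-injective eq)

module BlowUp {d T : ℕ} (K : CompleteColouring d T) (n s : ℕ) (n>0 : 0 < n) (s<n : s < n) where
  open CompleteColouring K
  module Bip = BipartiteColouring n s s<n

  instance
    n-nonZero : NonZero n
    n-nonZero = >-nonZero n>0

  k : ℕ
  k = suc (suc d)

  G : GraphOn (Fin k × Fin n)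
  G = completeBalancedMultipartite k n

  blockColour : ℕ → ℕ → ℕ → ℕ → ℕ
  blockColour u a v b = suc (n * pred (colour u v) + Bip.colour a b)

  low high : ℕ → ℕ → ℕ
  low u a  = suc (n * pred (start u) + Bip.start a)
  high u a = n * (start u + d) + Bip.start a

  block-in-window : ∀ {u v a b} → u < k → v < k → u ≢ v → a < n → b < n →
                    low u a ≤ blockColour u a v b × blockColour u a v b ≤ high u a
  block-in-window {u} {v} {a} {b} u<k v<k u≢v a<n b<n with ≥1⇒suc (start-pos u<k)
  ... | L , start≡1+L with window u<k v<k u≢v | Bip.window a<n b<n
  ... | start≤c , c≤start+d | g≤φ , φ<g+n rewrite start≡1+L =
    block-window n (pred-mono-≤ start≤c) (pred-mono-≤ c≤start+d) g≤φ φ<g+n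

  col : Fin k × Fin n → Fin k × Fin n → ℕ
  col (i , a) (j , b) = blockColour (toℕ i) (toℕ a) (toℕ j) (toℕ b)

  Adj : Fin k × Fin n → Fin k × Fin n → Set
  Adj = GraphOn.Adj G

  col-symmetric : ∀ x y → Adj x y → col y x ≡ col x y
  col-symmetric (i , a) (j , b) i≢j =
    cong₂ (λ c φ → suc (n * pred c + φ))
          (symmetric (toℕ<n j) (toℕ<n i) (toℕ-≢ (λ j≡i → i≢j (sym j≡i))))
          (Bip.colour-sym (toℕ b) (toℕ a))

  -- The top of every window is at most nT + s since start u + d ≤ T
  -- and min(a,s) ≤ s.
  col-range : ∀ x y → Adj x y → 1 ≤ col x y × col x y ≤ n * T + s
  col-range (i , a) (j , b) i≢j =
    s≤s z≤n ,
    ≤-trans (proj₂ (block-in-window (toℕ<n i) (toℕ<n j) (toℕ-≢ i≢j) (toℕ<n a) (toℕ<n b)))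
            (+-mono-≤ (*-monoʳ-≤ n (window-top (toℕ<n i))) (m⊓n≤n (toℕ a) s))

  -- Decode x as a block colour: the quotient is a colour of K_k, the
  -- remainder a colour of K_{n,n}.
  col-all-used : ∀ x → 1 ≤ x → x ≤ n * T + s → Σ _ λ y → Σ _ λ z → Σ (Adj y z) λ _ → col y z ≡ x
  col-all-used x 1≤x x≤nT+s with block-cover n s T x T-pos 1≤x x≤nT+s
  ... | Q , R , Q<T , R<n+s , refl with all-used {suc Q} (s≤s z≤n) Q<T | Bip.every-colour R<n+s
  ... | u , v , u<k , v<k , u≢v , c≡1+Q | a , b , a<n , b<n , φ≡R
    with toFin u u<k | toFin v v<k | toFin a a<n | toFin b b<n
  ... | i , refl | j , refl | a' , refl | b' , refl =
    (i , a') , (j , b') , (λ i≡j → u≢v (cong toℕ i≡j)) ,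
    cong₂ (λ c φ → suc (n * pred c + φ)) c≡1+Q φ≡R

  -- Equal colours at (i,a): the remainders lie in the window of a, so the
  -- quotients and the remainders agree, and both colourings are proper.
  col-proper : ∀ x y z → Adj x y → Adj x z → col x y ≡ col x z → y ≡ z
  col-proper (i , a) (j , b) (j' , b') i≢j i≢j' eq
    with Bip.window (toℕ<n a) (toℕ<n b) | Bip.window (toℕ<n a) (toℕ<n b')
  ... | g≤φ , φ<g+n | g≤φ' , φ'<g+n with block-injective n g≤φ φ<g+n g≤φ' φ'<g+n (suc-injective eq)
  ... | pred≡ , φ≡φ' = cong₂ _,_ (toℕ-injective j≡j') (toℕ-injective b≡b')
    where
    u<k = toℕ<n i
    positive : ∀ {j} → ¬ i ≡ j → NonZero (colour (toℕ i) (toℕ j))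
    positive {j} i≢j = >-nonZero (≤-trans (start-pos u<k) (proj₁ (window u<k (toℕ<n j) (toℕ-≢ i≢j))))
    c≡c' : colour (toℕ i) (toℕ j) ≡ colour (toℕ i) (toℕ j')
    c≡c' = trans (sym (suc-pred _ {{positive i≢j}})) (trans (cong suc pred≡) (suc-pred _ {{positive i≢j'}}))
    j≡j' = injective u<k (toℕ<n j) (toℕ<n j') (toℕ-≢ i≢j) (toℕ-≢ i≢j') c≡c'
    b≡b' = Bip.injective (toℕ<n a) (toℕ<n b) (toℕ<n b') φ≡φ'

  -- The colours at (i,a) are exactly those in [low, high]: block-in-window
  -- for one direction, block-decode followed by onto of both colourings for
  -- the other.
  col-interval : ∀ x → (∀ y → ¬ Adj x y) ⊎ Σ ℕ λ lo → Σ ℕ λ hi →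
                   ∀ c → ((lo ≤ c × c ≤ hi) → Σ _ λ y → Σ (Adj x y) λ _ → col x y ≡ c)
                       × ((Σ _ λ y → Σ (Adj x y) λ _ → col x y ≡ c) → lo ≤ c × c ≤ hi)
  col-interval (i , a) = inj₂ (low u a' , high u a' , λ c → reach c , bounded c)
    where
    u = toℕ i
    a' = toℕ a
    bounded : ∀ c → (Σ _ λ y → Σ (Adj (i , a) y) λ _ → col (i , a) y ≡ c) → low u a' ≤ c × c ≤ high u a'
    bounded c ((j , b) , i≢j , refl) = block-in-window (toℕ<n i) (toℕ<n j) (toℕ-≢ i≢j) (toℕ<n a) (toℕ<n b)
    reach : ∀ c → low u a' ≤ c × c ≤ high u a' → Σ _ λ y → Σ (Adj (i , a) y) λ _ → col (i , a) y ≡ c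
    reach c (low≤c , c≤high) with ≥1⇒suc (start-pos (toℕ<n i))
    ... | L , start≡1+L with block-decode n L d (Bip.start a') c
                               (subst (λ z → suc (n * pred z + Bip.start a') ≤ c) start≡1+L low≤c)
                               (subst (λ z → c ≤ n * (z + d) + Bip.start a') start≡1+L c≤high)
    ... | Q , R , Q≤d , R<n , refl
      with onto (toℕ<n i) (subst (_≤ suc (L + Q)) (sym start≡1+L) (s≤s (m≤m+n L Q)))
                          (subst (suc (L + Q) ≤_) (cong (_+ d) (sym start≡1+L)) (s≤s (+-monoʳ-≤ L Q≤d)))
         | Bip.onto (toℕ<n a) (m≤m+n (Bip.start a') R) (+-monoʳ-< (Bip.start a') R<n)
    ... | v , v<k , u≢v , c≡ | b , b<n , φ≡ with toFin v v<k | toFin b b<n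
    ... | j , refl | b' , refl =
      (j , b') , (λ i≡j → u≢v (cong toℕ i≡j)) , cong₂ (λ c φ → suc (n * pred c + φ)) c≡ φ≡

  colouring : HasIntervalColoring G (n * T + s)
  colouring = col , record
    { symmetric = col-symmetric
    ; inRange   = col-range
    ; allUsed   = col-all-used
    ; proper    = col-proper
    ; interval  = col-interval
    }

ifSame : ℕ → ℕ → ℕ → ℕ → ℕ
ifSame x y p q = if does (x ≟ y) then p else q

ifSame-≡ : ∀ {x y} p q → x ≡ y → ifSame x y p q ≡ p
ifSame-≡ {x} {y} p q x≡y rewrite dec-true (x ≟ y) x≡y = refl

ifSame-≢ : ∀ {x y} p q → x ≢ y → ifSame x y p q ≡ q
ifSame-≢ {x} {y} p q x≢y rewrite dec-false (x ≟ y) x≢y = refl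

unshift : ∀ {z a b} D → a + D ≤ z → z ≤ b + D → Σ ℕ λ w → a ≤ w × w ≤ b × w + D ≡ z
unshift {z} {a} {b} D a+D≤z z≤b+D with ≤⇒∃+ a+D≤z
... | k , refl = a + k , m≤m+n a k , +-cancelʳ-≤ D _ _ (≤-trans (≤-reflexive (reorder a k D)) z≤b+D) , reorder a k D
  where
  reorder : ∀ a k D → a + k + D ≡ a + D + k
  reorder = solve-∀

-- From an interval T-colouring of K_m (m = d + 2) colour K_{2m},
-- whose vertices are two copies (σ,x), σ ∈ Bool, of the vertices x of K_m:
--   inside copy false  colour(x,y),
--   inside copy true   colour(x,y) + 2m - 1,
--   across the copies  colour(x,y) + m - 1 for x ≠ y, and start x + 2m - 2
--                      between (false,x) and (true,x).
-- At (false,x) these fill [start x, start x + 2m - 2] from the bottom and at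
-- (true,x) the window shifted up by m - 1; altogether T + 2m - 1 colours.
module Doubling {d T : ℕ} (K : CompleteColouring d T) where
  open CompleteColouring K

  m d₂ δ₁ δ₂ : ℕ
  m  = suc (suc d)
  d₂ = d + m
  δ₁ = suc d
  δ₂ = suc d₂

  cross : ℕ → ℕ → ℕ
  cross x y = ifSame x y (start x + d₂) (colour x y + δ₁)

  colour₂ : Bool → ℕ → Bool → ℕ → ℕ
  colour₂ false x false y = colour x y
  colour₂ false x true  y = cross x y
  colour₂ true  x false y = cross x y
  colour₂ true  x true  y = colour x y + δ₂

  start₂ : Bool → ℕ → ℕ
  start₂ false x = start x
  start₂ true  x = start x + δ₁

  Distinct : Bool → ℕ → Bool → ℕ → Set
  Distinct σ x τ y = ¬ (σ ≡ τ × x ≡ y)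

  δ₁≤d₂ : δ₁ ≤ d₂
  δ₁≤d₂ = ≤-trans (n≤1+n δ₁) (m≤n+m m d)

  d+δ₁≤d₂ : d + δ₁ ≤ d₂
  d+δ₁≤d₂ = +-monoʳ-≤ d (n≤1+n δ₁)

  top-regroup : ∀ a d d₂ → a + d + suc d₂ ≡ a + suc d + d₂
  top-regroup = solve-∀

  -- One above the top shifted cross colour is the diagonal colour.
  last-shifted : ∀ a → suc (a + d + δ₁) ≡ a + d₂
  last-shifted a = grow a d
    where
    grow : ∀ a d → suc (a + d + suc d) ≡ a + (d + suc (suc d))
    grow = solve-∀

  cross-window : ∀ {x y} → x < m → y < m → start x + δ₁ ≤ cross x y × cross x y ≤ start x + d₂
  cross-window {x} {y} x<m y<m with x ≟ y
  ... | yes x≡y rewrite ifSame-≡ (start x + d₂) (colour x y + δ₁) x≡y = +-monoʳ-≤ (start x) δ₁≤d₂ , ≤-refl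
  ... | no x≢y rewrite ifSame-≢ (start x + d₂) (colour x y + δ₁) x≢y with window x<m y<m x≢y
  ...   | start≤c , c≤start+d =
    +-monoˡ-≤ δ₁ start≤c ,
    ≤-trans (+-monoˡ-≤ δ₁ c≤start+d) (≤-trans (≤-reflexive (+-assoc (start x) d δ₁)) (+-monoʳ-≤ (start x) d+δ₁≤d₂))

  cross-symmetric : ∀ {x y} → x < m → y < m → cross x y ≡ cross y x
  cross-symmetric {x} {y} x<m y<m with x ≟ y
  ... | yes refl = refl
  ... | no x≢y = begin
    cross x y          ≡⟨ ifSame-≢ _ _ x≢y ⟩
    colour x y + δ₁    ≡⟨ cong (_+ δ₁) (symmetric x<m y<m x≢y) ⟩
    colour y x + δ₁    ≡⟨ ifSame-≢ _ _ (λ y≡x → x≢y (sym y≡x)) ⟨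
    cross y x          ∎
    where open ≡-Reasoning

  shifted<diagonal : ∀ {x y} → x < m → y < m → x ≢ y → colour x y + δ₁ < start x + d₂
  shifted<diagonal {x} x<m y<m x≢y =
    ≤-trans (s≤s (+-monoˡ-≤ δ₁ (proj₂ (window x<m y<m x≢y)))) (≤-reflexive (last-shifted (start x)))

  cross-injective : ∀ {x y y'} → x < m → y < m → y' < m → cross x y ≡ cross x y' → y ≡ y'
  cross-injective {x} {y} {y'} x<m y<m y'<m eq with x ≟ y | x ≟ y'
  ... | yes x≡y | yes x≡y' = trans (sym x≡y) x≡y'
  ... | no x≢y  | no x≢y' =
    injective x<m y<m y'<m x≢y x≢y' (+-cancelʳ-≡ δ₁ _ _ (trans (sym (ifSame-≢ _ _ x≢y)) (trans eq (ifSame-≢ _ _ x≢y'))))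
  ... | yes x≡y | no x≢y' = ⊥-elim (<⇒≢ (shifted<diagonal x<m y'<m x≢y')
    (trans (sym (ifSame-≢ _ _ x≢y')) (trans (sym eq) (ifSame-≡ _ _ x≡y))))
  ... | no x≢y  | yes x≡y' = ⊥-elim (<⇒≢ (shifted<diagonal x<m y<m x≢y)
    (trans (sym (ifSame-≢ _ _ x≢y)) (trans eq (ifSame-≡ _ _ x≡y'))))

  inner<cross : ∀ {x y y'} → x < m → y < m → y' < m → x ≢ y → colour x y < cross x y'
  inner<cross {x} x<m y<m y'<m x≢y =
    ≤-trans (s≤s (proj₂ (window x<m y<m x≢y))) (≤-trans (≤-reflexive (sym (+-suc (start x) d))) (proj₁ (cross-window x<m y'<m)))

  cross<inner : ∀ {x y y'} → x < m → y < m → y' < m → x ≢ y' → cross x y < colour x y' + δ₂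
  cross<inner {x} x<m y<m y'<m x≢y' =
    ≤-trans (s≤s (proj₂ (cross-window x<m y<m)))
            (≤-trans (≤-reflexive (sym (+-suc (start x) d₂))) (+-monoˡ-≤ δ₂ (proj₁ (window x<m y'<m x≢y'))))

  window₂ : ∀ σ x τ y → x < m → y < m → Distinct σ x τ y →
            start₂ σ x ≤ colour₂ σ x τ y × colour₂ σ x τ y ≤ start₂ σ x + d₂
  window₂ false x false y x<m y<m x≢y with window x<m y<m (λ x≡y → x≢y (refl , x≡y))
  ... | lo , hi = lo , ≤-trans hi (+-monoʳ-≤ (start x) (m≤m+n d m))
  window₂ false x true y x<m y<m _ with cross-window x<m y<m
  ... | lo , hi = ≤-trans (m≤m+n (start x) δ₁) lo , hi
  window₂ true x false y x<m y<m _ with cross-window x<m y<m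
  ... | lo , hi = lo , ≤-trans hi (+-monoˡ-≤ d₂ (m≤m+n (start x) δ₁))
  window₂ true x true y x<m y<m x≢y with window x<m y<m (λ x≡y → x≢y (refl , x≡y))
  ... | lo , hi = ≤-trans (+-monoʳ-≤ (start x) (≤-trans δ₁≤d₂ (n≤1+n d₂))) (+-monoˡ-≤ δ₂ lo) ,
                  ≤-trans (+-monoˡ-≤ δ₂ hi) (≤-reflexive (top-regroup (start x) d d₂))

  symmetric₂ : ∀ σ x τ y → x < m → y < m → Distinct σ x τ y → colour₂ σ x τ y ≡ colour₂ τ y σ x
  symmetric₂ false x false y x<m y<m x≢y = symmetric x<m y<m (λ x≡y → x≢y (refl , x≡y))
  symmetric₂ false x true  y x<m y<m _   = cross-symmetric x<m y<m
  symmetric₂ true  x false y x<m y<m _   = cross-symmetric x<m y<m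
  symmetric₂ true  x true  y x<m y<m x≢y = cong (_+ δ₂) (symmetric x<m y<m (λ x≡y → x≢y (refl , x≡y)))

  -- Inner and cross colours at a vertex are separated, so equal colours come
  -- from the same kind of edge, where injectivity is inherited.
  injective₂ : ∀ σ x τ y τ' y' → x < m → y < m → y' < m → Distinct σ x τ y → Distinct σ x τ' y' →
               colour₂ σ x τ y ≡ colour₂ σ x τ' y' → τ ≡ τ' × y ≡ y'
  injective₂ false x false y false y' x<m y<m y'<m ne ne' eq =
    refl , injective x<m y<m y'<m (λ e → ne (refl , e)) (λ e → ne' (refl , e)) eq
  injective₂ false x true y true y' x<m y<m y'<m ne ne' eq = refl , cross-injective x<m y<m y'<m eq
  injective₂ false x false y true y' x<m y<m y'<m ne ne' eq =
    ⊥-elim (<⇒≢ (inner<cross x<m y<m y'<m (λ e → ne (refl , e))) eq)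
  injective₂ false x true y false y' x<m y<m y'<m ne ne' eq =
    ⊥-elim (<⇒≢ (inner<cross x<m y'<m y<m (λ e → ne' (refl , e))) (sym eq))
  injective₂ true x false y false y' x<m y<m y'<m ne ne' eq = refl , cross-injective x<m y<m y'<m eq
  injective₂ true x true y true y' x<m y<m y'<m ne ne' eq =
    refl , injective x<m y<m y'<m (λ e → ne (refl , e)) (λ e → ne' (refl , e)) (+-cancelʳ-≡ δ₂ _ _ eq)
  injective₂ true x false y true y' x<m y<m y'<m ne ne' eq =
    ⊥-elim (<⇒≢ (cross<inner x<m y<m y'<m (λ e → ne' (refl , e))) eq)
  injective₂ true x true y false y' x<m y<m y'<m ne ne' eq =
    ⊥-elim (<⇒≢ (cross<inner x<m y'<m y<m (λ e → ne (refl , e))) (sym eq))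

  -- A colour in the window of (σ,x) is an inner colour, a shifted cross
  -- colour or the diagonal colour start x + d₂, according to its range.
  onto₂ : ∀ σ x z → x < m → start₂ σ x ≤ z → z ≤ start₂ σ x + d₂ →
          Σ Bool λ τ → Σ ℕ λ y → y < m × Distinct σ x τ y × colour₂ σ x τ y ≡ z
  onto₂ false x z x<m lo hi with z ≤? start x + d
  ... | yes z≤ with onto x<m lo z≤
  ...   | y , y<m , x≢y , eq = false , y , y<m , (λ e → x≢y (proj₂ e)) , eq
  onto₂ false x z x<m lo hi | no z≰ with z <? start x + d₂
  ... | yes z< with unshift {z} {start x} {start x + d} δ₁ (subst (_≤ z) (sym (+-suc (start x) d)) (≰⇒> z≰))
                                                      (≤-pred (subst (z <_) (sym (last-shifted (start x))) z<))
  ...   | w , lo' , hi' , refl with onto x<m lo' hi'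
  ...     | y , y<m , x≢y , refl = true , y , y<m , (λ { (() , _) }) , ifSame-≢ _ _ x≢y
  onto₂ false x z x<m lo hi | no z≰ | no z≮ =
    true , x , x<m , (λ { (() , _) }) , trans (ifSame-≡ {x} {x} (start x + d₂) (colour x x + δ₁) refl) (≤-antisym (≮⇒≥ z≮) hi)
  onto₂ true x z x<m lo hi with z <? start x + d₂
  ... | yes z< with unshift {z} {start x} {start x + d} δ₁ lo (≤-pred (subst (z <_) (sym (last-shifted (start x))) z<))
  ...   | w , lo' , hi' , refl with onto x<m lo' hi'
  ...     | y , y<m , x≢y , refl = false , y , y<m , (λ { (() , _) }) , ifSame-≢ _ _ x≢y
  onto₂ true x z x<m lo hi | no z≮ with z ≟ start x + d₂
  ... | yes refl = false , x , x<m , (λ { (() , _) }) , ifSame-≡ {x} {x} (start x + d₂) (colour x x + δ₁) refl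
  ... | no z≢ with unshift {z} {start x} {start x + d} δ₂
                     (subst (_≤ z) (sym (+-suc (start x) d₂)) (≤∧≢⇒< (≮⇒≥ z≮) (λ e → z≢ (sym e))))
                     (subst (z ≤_) (sym (top-regroup (start x) d d₂)) hi)
  ...   | w , lo' , hi' , refl with onto x<m lo' hi'
  ...     | y , y<m , x≢y , refl = true , y , y<m , (λ e → x≢y (proj₂ e)) , refl

  -- Colours up to 2m - 1 occur at a vertex whose window starts at 1 (one
  -- exists, as colour 1 occurs); the others occur inside copy true.
  all-used₂ : ∀ {z} → 1 ≤ z → z ≤ T + δ₂ →
              Σ Bool λ σ → Σ ℕ λ x → Σ Bool λ τ → Σ ℕ λ y → x < m × y < m × Distinct σ x τ y × colour₂ σ x τ y ≡ z
  all-used₂ {z} 1≤z z≤T+δ₂ with z ≤? δ₂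
  ... | yes z≤δ₂ with all-used {1} ≤-refl T-pos
  ...   | x , y , x<m , y<m , x≢y , c≡1 with onto₂ false x z x<m (subst (_≤ z) (sym start≡1) 1≤z)
                                                             (subst (λ a → z ≤ a + d₂) (sym start≡1) z≤δ₂)
    where
    start≡1 : start x ≡ 1
    start≡1 = ≤-antisym (subst (start x ≤_) c≡1 (proj₁ (window x<m y<m x≢y))) (start-pos x<m)
  ...     | τ , y' , y'<m , ne , eq = false , x , τ , y' , x<m , y'<m , ne , eq
  all-used₂ {z} 1≤z z≤T+δ₂ | no z≰δ₂ with unshift {z} {1} {T} δ₂ (≰⇒> z≰δ₂) z≤T+δ₂
  ... | w , 1≤w , w≤T , refl with all-used 1≤w w≤T
  ...   | x , y , x<m , y<m , x≢y , refl = true , x , true , y , x<m , y<m , (λ e → x≢y (proj₂ e)) , refl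

  -- Vertex u < 2m of K_{2m} is (false, u) if u < m and (true, u - m) otherwise.
  side : ℕ → Bool
  side u = does (m ≤? u)

  index : ℕ → ℕ
  index u = if side u then u ∸ m else u

  embed : Bool → ℕ → ℕ
  embed false x = x
  embed true  x = m + x

  side-index-embed : ∀ σ {x} → x < m → side (embed σ x) ≡ σ × index (embed σ x) ≡ x
  side-index-embed false {x} x<m rewrite dec-false (m ≤? x) (<⇒≱ x<m) = refl , refl
  side-index-embed true  {x} x<m rewrite dec-true (m ≤? m + x) (m≤m+n m x) = refl , m+n∸m≡n m x

  split-vertex : ∀ u → u < m + m → Σ Bool λ σ → Σ ℕ λ x → x < m × u ≡ embed σ x
  split-vertex u u<2m with m ≤? u
  ... | no m≰u  = false , u , ≰⇒> m≰u , refl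
  ... | yes m≤u = true , u ∸ m , m<n+o⇒m∸n<o u m u<2m , sym (m+[n∸m]≡n m≤u)

  embed< : ∀ σ {x} → x < m → embed σ x < m + m
  embed< false x<m = ≤-trans x<m (m≤m+n m m)
  embed< true  x<m = +-monoʳ-< m x<m

  embed-≢ : ∀ {σ x τ y} → x < m → y < m → Distinct σ x τ y → embed σ x ≢ embed τ y
  embed-≢ {σ} {x} {τ} {y} x<m y<m ne eq with side-index-embed σ x<m | side-index-embed τ y<m
  ... | σ≡ , x≡ | τ≡ , y≡ =
    ne (trans (sym σ≡) (trans (cong side eq) τ≡) , trans (sym x≡) (trans (cong index eq) y≡))

  ≢-embed : ∀ {σ x τ y} → embed σ x ≢ embed τ y → Distinct σ x τ y
  ≢-embed ne (refl , refl) = ne refl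

  colourℕ : ℕ → ℕ → ℕ
  colourℕ u v = colour₂ (side u) (index u) (side v) (index v)

  startℕ : ℕ → ℕ
  startℕ u = start₂ (side u) (index u)

  colour-embed : ∀ σ τ {x y} → x < m → y < m → colourℕ (embed σ x) (embed τ y) ≡ colour₂ σ x τ y
  colour-embed σ τ x<m y<m with side-index-embed σ x<m | side-index-embed τ y<m
  ... | σ≡ , x≡ | τ≡ , y≡ rewrite σ≡ | x≡ | τ≡ | y≡ = refl

  start-embed : ∀ σ {x} → x < m → startℕ (embed σ x) ≡ start₂ σ x
  start-embed σ x<m with side-index-embed σ x<m
  ... | σ≡ , x≡ rewrite σ≡ | x≡ = refl

  doubled : CompleteColouring d₂ (T + δ₂)
  doubled = record
    { colour     = colourℕ
    ; start      = startℕ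
    ; symmetric  = symmetricℕ
    ; start-pos  = start-posℕ
    ; window-top = window-topℕ
    ; window     = windowℕ
    ; injective  = injectiveℕ
    ; onto       = ontoℕ
    ; all-used   = all-usedℕ
    }
    where
    symmetricℕ : ∀ {u v} → u < m + m → v < m + m → u ≢ v → colourℕ u v ≡ colourℕ v u
    symmetricℕ {u} {v} u< v< u≢v with split-vertex u u< | split-vertex v v<
    ... | σ , x , x<m , refl | τ , y , y<m , refl = begin
      colourℕ (embed σ x) (embed τ y) ≡⟨ colour-embed σ τ x<m y<m ⟩
      colour₂ σ x τ y                 ≡⟨ symmetric₂ σ x τ y x<m y<m (≢-embed u≢v) ⟩
      colour₂ τ y σ x                 ≡⟨ colour-embed τ σ y<m x<m ⟨
      colourℕ (embed τ y) (embed σ x) ∎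
      where open ≡-Reasoning

    start-posℕ : ∀ {u} → u < m + m → 1 ≤ startℕ u
    start-posℕ {u} u< with split-vertex u u<
    ... | false , x , x<m , refl rewrite start-embed false x<m = start-pos x<m
    ... | true  , x , x<m , refl rewrite start-embed true x<m = ≤-trans (start-pos x<m) (m≤m+n _ δ₁)

    window-topℕ : ∀ {u} → u < m + m → startℕ u + d₂ ≤ T + δ₂
    window-topℕ {u} u< with split-vertex u u<
    ... | false , x , x<m , refl rewrite start-embed false x<m =
      +-mono-≤ (≤-trans (m≤m+n _ d) (window-top x<m)) (n≤1+n d₂)
    ... | true  , x , x<m , refl rewrite start-embed true x<m =
      ≤-trans (≤-reflexive (sym (top-regroup (start x) d d₂))) (+-monoˡ-≤ δ₂ (window-top x<m))

    windowℕ : ∀ {u v} → u < m + m → v < m + m → u ≢ v → startℕ u ≤ colourℕ u v × colourℕ u v ≤ startℕ u + d₂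
    windowℕ {u} {v} u< v< u≢v with split-vertex u u< | split-vertex v v<
    ... | σ , x , x<m , refl | τ , y , y<m , refl
      rewrite colour-embed σ τ x<m y<m | start-embed σ x<m =
      window₂ σ x τ y x<m y<m (≢-embed u≢v)

    injectiveℕ : ∀ {u v w} → u < m + m → v < m + m → w < m + m → u ≢ v → u ≢ w → colourℕ u v ≡ colourℕ u w → v ≡ w
    injectiveℕ {u} {v} {w} u< v< w< u≢v u≢w eq with split-vertex u u< | split-vertex v v< | split-vertex w w<
    ... | σ , x , x<m , refl | τ , y , y<m , refl | τ' , y' , y'<m , refl
      with injective₂ σ x τ y τ' y' x<m y<m y'<m (≢-embed u≢v) (≢-embed u≢w)
             (trans (sym (colour-embed σ τ x<m y<m)) (trans eq (colour-embed σ τ' x<m y'<m)))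
    ... | refl , refl = refl

    ontoℕ : ∀ {u z} → u < m + m → startℕ u ≤ z → z ≤ startℕ u + d₂ →
            Σ ℕ λ v → v < m + m × u ≢ v × colourℕ u v ≡ z
    ontoℕ {u} {z} u< lo hi with split-vertex u u<
    ... | σ , x , x<m , refl
      with onto₂ σ x z x<m (subst (_≤ z) (start-embed σ x<m) lo) (subst (λ a → z ≤ a + d₂) (start-embed σ x<m) hi)
    ... | τ , y , y<m , ne , eq = embed τ y , embed< τ y<m , embed-≢ x<m y<m ne , trans (colour-embed σ τ x<m y<m) eq

    all-usedℕ : ∀ {z} → 1 ≤ z → z ≤ T + δ₂ →
                Σ ℕ λ u → Σ ℕ λ v → u < m + m × v < m + m × u ≢ v × colourℕ u v ≡ z
    all-usedℕ 1≤z z≤ with all-used₂ 1≤z z≤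
    ... | σ , x , τ , y , x<m , y<m , ne , eq =
      embed σ x , embed τ y , embed< σ x<m , embed< τ y<m , embed-≢ x<m y<m ne , trans (colour-embed σ τ x<m y<m) eq

odd≢even : ∀ x y → suc (x + x) ≢ y + y
odd≢even x zero ()
odd≢even zero (suc y) eq with trans (suc-injective eq) (+-suc y y)
... | ()
odd≢even (suc x) (suc y) eq =
  odd≢even x y (suc-injective (trans (sym (cong suc (+-suc x x))) (trans (suc-injective eq) (+-suc y y))))

halve : ∀ x → Σ ℕ λ h → x ≡ h + h ⊎ x ≡ suc (h + h)
halve zero = 0 , inj₁ refl
halve (suc x) with halve x
... | h , inj₁ refl = h , inj₂ refl
... | h , inj₂ refl = suc h , inj₁ (cong suc (sym (+-suc h h)))

double-injective : ∀ {i j} → i + i ≡ j + j → i ≡ j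
double-injective {i} {j} eq with <-cmp i j
... | tri< i<j _ _ = ⊥-elim (<⇒≢ (+-mono-< i<j i<j) eq)
... | tri≈ _ i≡j _ = i≡j
... | tri> _ _ j<i = ⊥-elim (<⇒≢ (+-mono-< j<i j<i) (sym eq))

double-cancel-≤ : ∀ {i j} → i + i ≤ j + j → i ≤ j
double-cancel-≤ {i} {j} i+i≤j+j with i ≤? j
... | yes i≤j = i≤j
... | no i≰j = ⊥-elim (<⇒≱ (+-mono-< (≰⇒> i≰j) (≰⇒> i≰j)) i+i≤j+j)

∸-past : ∀ {N} i j c → N ≤ i + j → N ≤ c + j → N + (i ∸ c) ≤ i + j
∸-past {N} i j c N≤i+j N≤c+j with c ≤? i
... | yes c≤i = begin
  N + (i ∸ c)      ≤⟨ +-monoˡ-≤ (i ∸ c) N≤c+j ⟩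
  c + j + (i ∸ c)  ≡⟨ reorder c j (i ∸ c) ⟩
  c + (i ∸ c) + j  ≡⟨ cong (_+ j) (m+[n∸m]≡n c≤i) ⟩
  i + j            ∎
  where
  open ≤-Reasoning
  reorder : ∀ c j x → c + j + x ≡ c + x + j
  reorder = solve-∀
... | no c≰i rewrite m≤n⇒m∸n≡0 (<⇒≤ (≰⇒> c≰i)) | +-identityʳ N = N≤i+j

-- With M' = a + e, M = M' + 1 and N = M + M' (odd),
-- colour K_{N+1} = K_{2M} with T = N + e colours, so any 2M-1 ≤ T ≤ 3M-2.
-- The edge between vertices i, j < N gets i + j, reduced by N from the
-- threshold N + offset i on, so row i is a rotated row with window
-- [offset i, offset i + N); the offsets are chosen so that the thresholds of
-- rows i and j agree on i + j, which makes the table symmetric.  The extra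
-- vertex N is joined to i by the diagonal colour of row i; the diagonal
-- runs through 0,…,N-1, so N gets the window [0, N-1].  Finally all colours
-- are raised by 1.
module Cyclic (a e : ℕ) where
  M' M N d : ℕ
  M' = a + e
  M  = suc M'
  N  = M + M'
  d  = M' + M'

  N≡a+[M+e] : N ≡ a + (M + e)
  N≡a+[M+e] = regroup a e
    where
    regroup : ∀ a e → suc (a + e) + (a + e) ≡ a + (suc (a + e) + e)
    regroup = solve-∀

  data Region (i : ℕ) : Set where
    low  : i < M → Region i
    mid  : M ≤ i → i < M + e → Region i
    high : M + e ≤ i → Region i

  region : ∀ i → Region i
  region i with i <? M | i <? M + e
  ... | yes i<M | _         = low i<M
  ... | no i≮M  | yes i<M+e = mid (≮⇒≥ i≮M) i<M+e
  ... | no _    | no i≮M+e  = high (≮⇒≥ i≮M+e)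

  offsetOf : ∀ {i} → Region i → ℕ
  offsetOf {i} (low _)   = i ∸ a
  offsetOf {i} (mid _ _) = i ∸ M'
  offsetOf     (high _)  = 0

  offset : ℕ → ℕ
  offset i = offsetOf (region i)

  offset≤i : ∀ i → offset i ≤ i
  offset≤i i with region i
  ... | low _   = m∸n≤m i a
  ... | mid _ _ = m∸n≤m i M'
  ... | high _  = z≤n

  offset≤e : ∀ i → offset i ≤ e
  offset≤e i with region i
  ... | low i<M       = subst (i ∸ a ≤_) (m+n∸m≡n a e) (∸-monoˡ-≤ a (≤-pred i<M))
  ... | mid _ i<M+e   = m≤n+o⇒m∸n≤o i M' (≤-pred i<M+e)
  ... | high _        = z≤n

  -- In regions low and mid, j is its offset plus at most a, resp. M'.
  recover : ∀ j c → j ≤ j ∸ c + c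
  recover j c = subst (j ≤_) (+-comm c (j ∸ c)) (m≤n+m∸n j c)

  -- Removing the offset x of j from a sum past the threshold N.
  past-shift : ∀ {i j x c} → j ≤ x + c → N + x ≤ i + j → N ≤ i + c
  past-shift {i} {j} {x} {c} j≤x+c past = +-cancelʳ-≤ j N (i + c) (begin
    N + j        ≤⟨ +-monoʳ-≤ N j≤x+c ⟩
    N + (x + c)  ≡⟨ +-assoc N x c ⟨
    N + x + c    ≤⟨ +-monoˡ-≤ c past ⟩
    i + j + c    ≡⟨ reorder i j c ⟩
    i + c + j    ∎)
    where
    open ≤-Reasoning
    reorder : ∀ i j c → i + j + c ≡ i + c + j
    reorder = solve-∀

  past⇒N≤ : ∀ {x y} → N + x ≤ y → N ≤ y
  past⇒N≤ {x} past = ≤-trans (m≤m+n N x) past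

  -- Consistency of the thresholds: if i + j is past the threshold of row j,
  -- it is past the threshold of row i.  For i low this forces j high, for
  -- i mid it forces j ≥ M; then ∸-past applies.
  threshold-consistent : ∀ i j → N + offset j ≤ i + j → N + offset i ≤ i + j
  threshold-consistent i j past with region i | region j
  ... | high _ | _ = subst (_≤ i + j) (sym (+-identityʳ N)) (past⇒N≤ past)
  ... | low _ | high M+e≤j =
    ∸-past i j a (past⇒N≤ past) (subst (_≤ a + j) (sym N≡a+[M+e]) (+-monoʳ-≤ a M+e≤j))
  ... | low i<M | low _ =
    ⊥-elim (<⇒≱ (small i<M) (past-shift (≤-trans (recover j a) (+-monoʳ-≤ (j ∸ a) (m≤m+n a e))) past))
    where
    small : i < M → i + M' < N
    small i<M = +-monoˡ-< M' i<M
  ... | low i<M | mid _ _ =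
    ⊥-elim (<⇒≱ (+-monoˡ-< M' i<M) (past-shift (recover j M') past))
  ... | mid _ i<M+e | low _ =
    ⊥-elim (<⇒≱ (i+a<N i<M+e) (past-shift (recover j a) past))
    where
    i+a<N : i < M + e → i + a < N
    i+a<N i<M+e = subst (i + a <_) (trans (+-comm (M + e) a) (sym N≡a+[M+e])) (+-monoˡ-< a i<M+e)
  ... | mid _ _ | mid M≤j _ = ∸-past i j M' (past⇒N≤ past) (subst (_≤ M' + j) (+-comm M' M) (+-monoʳ-≤ M' M≤j))
  ... | mid _ _ | high M+e≤j =
    ∸-past i j M' (past⇒N≤ past) (subst (_≤ M' + j) (+-comm M' M) (+-monoʳ-≤ M' (≤-trans (m≤m+n M e) M+e≤j)))

  table : ℕ → ℕ → ℕ
  table i j = wrap (i + j) (N + offset i) N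

  table-sym : ∀ i j → table i j ≡ table j i
  table-sym i j = begin
    wrap (i + j) (N + offset i) N  ≡⟨ wrap-cong N (below-threshold i j) (below-threshold' i j) ⟩
    wrap (i + j) (N + offset j) N  ≡⟨ cong (λ x → wrap x (N + offset j) N) (+-comm i j) ⟩
    wrap (j + i) (N + offset j) N  ∎
    where
    open ≡-Reasoning
    below-threshold : ∀ i j → i + j < N + offset i → i + j < N + offset j
    below-threshold i j below with i + j <? N + offset j
    ... | yes below' = below'
    ... | no past = ⊥-elim (<⇒≱ below (threshold-consistent i j (≮⇒≥ past)))
    below-threshold' : ∀ i j → i + j < N + offset j → i + j < N + offset i
    below-threshold' i j below =
      subst (_< N + offset i) (+-comm j i) (below-threshold j i (subst (_< N + offset j) (+-comm i j) below))

  -- The diagonal i ↦ table i i is a bijection from {0,…,N-1} onto {0,…,d}: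
  -- it is 2i on the lower half and 2i - N (odd) on the upper half.
  diag-low : ∀ {i} → i < M → table i i ≡ i + i
  diag-low {i} i<M = wrap-below N (≤-trans (s≤s (+-mono-≤ (≤-pred i<M) (≤-pred i<M))) (m≤m+n N (offset i)))

  diag-high : ∀ {i} → M ≤ i → table i i ≡ i + i ∸ N
  diag-high {i} M≤i = wrap-above N (λ below → <⇒≱ below past)
    where
    offset≤ : offset i ≤ i ∸ M'
    offset≤ with region i
    ... | low i<M = ⊥-elim (<⇒≱ i<M M≤i)
    ... | mid _ _ = ≤-refl
    ... | high _  = z≤n
    past : N + offset i ≤ i + i
    past = begin
      N + offset i        ≤⟨ +-monoʳ-≤ N offset≤ ⟩
      M + M' + (i ∸ M')   ≡⟨ +-assoc M M' (i ∸ M') ⟩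
      M + (M' + (i ∸ M')) ≡⟨ cong (M +_) (m+[n∸m]≡n (≤-trans (n≤1+n M') M≤i)) ⟩
      M + i               ≤⟨ +-monoˡ-≤ i M≤i ⟩
      i + i               ∎
      where open ≤-Reasoning

  M≤i⇒N≤i+i : ∀ {i} → M ≤ i → N ≤ i + i
  M≤i⇒N≤i+i M≤i = +-mono-≤ M≤i (≤-trans (n≤1+n M') M≤i)

  diag-below : ∀ {i} → i < N → table i i ≤ d
  diag-below {i} i<N with M ≤? i
  ... | no M≰i  = subst (_≤ d) (sym (diag-low (≰⇒> M≰i))) (+-mono-≤ (≤-pred (≰⇒> M≰i)) (≤-pred (≰⇒> M≰i)))
  ... | yes M≤i = subst (_≤ d) (sym (diag-high M≤i)) (≤-pred (m<n+o⇒m∸n<o (i + i) N (+-mono-< i<N i<N)))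

  diag-parity : ∀ {i j} → i < M → M ≤ j → table i i ≢ table j j
  diag-parity {i} {j} i<M M≤j eq = odd≢even (i + M') j (begin
    suc (i + M' + (i + M'))  ≡⟨ regroup i M' ⟩
    i + i + N                ≡⟨ cong (_+ N) (trans (sym (diag-low i<M)) (trans eq (diag-high M≤j))) ⟩
    j + j ∸ N + N            ≡⟨ m∸n+n≡m (M≤i⇒N≤i+i M≤j) ⟩
    j + j                    ∎)
    where
    open ≡-Reasoning
    regroup : ∀ i M' → suc (i + M' + (i + M')) ≡ i + i + (suc M' + M')
    regroup = solve-∀

  diag-injective : ∀ {i j} → table i i ≡ table j j → i ≡ j
  diag-injective {i} {j} eq with M ≤? i | M ≤? j
  ... | no M≰i  | no M≰j  = double-injective (trans (sym (diag-low (≰⇒> M≰i))) (trans eq (diag-low (≰⇒> M≰j))))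
  ... | yes M≤i | yes M≤j = double-injective (begin
    i + i          ≡⟨ m∸n+n≡m (M≤i⇒N≤i+i M≤i) ⟨
    i + i ∸ N + N  ≡⟨ cong (_+ N) (trans (sym (diag-high M≤i)) (trans eq (diag-high M≤j))) ⟩
    j + j ∸ N + N  ≡⟨ m∸n+n≡m (M≤i⇒N≤i+i M≤j) ⟩
    j + j          ∎)
    where open ≡-Reasoning
  ... | no M≰i  | yes M≤j = ⊥-elim (diag-parity (≰⇒> M≰i) M≤j eq)
  ... | yes M≤i | no M≰j  = ⊥-elim (diag-parity (≰⇒> M≰j) M≤i (sym eq))

  -- x = 2h is the diagonal value at h, x = 2h + 1 the one at M + h.
  diag-onto : ∀ {x} → x ≤ d → Σ ℕ λ i → i < N × table i i ≡ x
  diag-onto {x} x≤d with halve x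
  ... | h , inj₁ refl = h , ≤-trans (s≤s h≤M') (m≤m+n M M') , diag-low (s≤s h≤M')
    where
    h≤M' : h ≤ M'
    h≤M' = double-cancel-≤ x≤d
  ... | h , inj₂ refl = M + h , +-monoʳ-< M h<M' , (begin
    table (M + h) (M + h)          ≡⟨ diag-high (m≤m+n M h) ⟩
    M + h + (M + h) ∸ N            ≡⟨ cong (_∸ N) (regroup a e h) ⟩
    N + suc (h + h) ∸ N            ≡⟨ m+n∸m≡n N (suc (h + h)) ⟩
    suc (h + h)                    ∎)
    where
    open ≡-Reasoning
    h<M' : h < M'
    h<M' = double-cancel-≤ (≤-trans (≤-reflexive (cong suc (+-suc h h))) (≤∧≢⇒< x≤d (odd≢even h M')))
    regroup : ∀ a e h → suc (a + e) + h + (suc (a + e) + h) ≡ suc (a + e) + (a + e) + suc (h + h)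
    regroup = solve-∀

  -- The colouring of K_{N+1} before raising colours by 1.  Row u < N reads
  -- the table at column partner u v: v itself, or u for the extra vertex N.
  partner : ℕ → ℕ → ℕ
  partner u v = ifSame v N u v

  colour₀ : ℕ → ℕ → ℕ
  colour₀ u v = ifSame u N (table v v) (table u (partner u v))

  start₀ : ℕ → ℕ
  start₀ u = ifSame u N 0 (offset u)

  colour₀-extra : ∀ v → colour₀ N v ≡ table v v
  colour₀-extra v = ifSame-≡ {N} {N} _ _ refl

  colour₀-row : ∀ {u} v → u ≢ N → colour₀ u v ≡ table u (partner u v)
  colour₀-row v u≢N = ifSame-≢ _ _ u≢N

  partner-extra : ∀ u → partner u N ≡ u
  partner-extra u = ifSame-≡ {N} {N} u N refl

  partner-other : ∀ {v} u → v ≢ N → partner u v ≡ v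
  partner-other u v≢N = ifSame-≢ u _ v≢N

  start₀-extra : start₀ N ≡ 0
  start₀-extra = ifSame-≡ {N} {N} 0 _ refl

  start₀-row : ∀ {u} → u ≢ N → start₀ u ≡ offset u
  start₀-row u≢N = ifSame-≢ 0 _ u≢N

  partner< : ∀ {u v} → u < N → v < suc N → partner u v < N
  partner< {u} {v} u<N v<1+N with v ≟ N
  ... | yes refl = subst (_< N) (sym (partner-extra u)) u<N
  ... | no v≢N  = subst (_< N) (sym (partner-other u v≢N)) (≤∧≢⇒< (≤-pred v<1+N) v≢N)

  partner-injective : ∀ {u v v'} → u ≢ v → u ≢ v' → partner u v ≡ partner u v' → v ≡ v'
  partner-injective {u} {v} {v'} u≢v u≢v' eq with v ≟ N | v' ≟ N
  ... | yes v≡N | yes v'≡N = trans v≡N (sym v'≡N)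
  ... | no v≢N  | no v'≢N  = trans (sym (partner-other u v≢N)) (trans eq (partner-other u v'≢N))
  ... | yes refl | no v'≢N = ⊥-elim (u≢v' (trans (sym (partner-extra u)) (trans eq (partner-other u v'≢N))))
  ... | no v≢N  | yes refl = ⊥-elim (u≢v (trans (sym (partner-extra u)) (trans (sym eq) (partner-other u v≢N))))

  module Row (u : ℕ) (u<N : u < N) = RotatedRow N u (offset u) (offset≤i u) u<N

  T : ℕ
  T = suc (d + e)

  below-extra : ∀ {u} → u < suc N → u ≢ N → u < N
  below-extra u<1+N u≢N = ≤∧≢⇒< (≤-pred u<1+N) u≢N

  offset-M' : offset M' ≡ e
  offset-M' with region M'
  ... | low _       = m+n∸m≡n a e
  ... | mid M≤M' _  = ⊥-elim (<⇒≱ (n<1+n M') M≤M')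
  ... | high M+e≤M' = ⊥-elim (<⇒≱ (n<1+n M') (≤-trans (m≤m+n M e) M+e≤M'))

  colouring : CompleteColouring d T
  colouring = record
    { colour     = λ u v → suc (colour₀ u v)
    ; start      = λ u → suc (start₀ u)
    ; symmetric  = symmetric
    ; start-pos  = λ _ → s≤s z≤n
    ; window-top = window-top
    ; window     = window
    ; injective  = injective
    ; onto       = onto
    ; all-used   = all-used
    }
    where
    symmetric : ∀ {u v} → u < suc N → v < suc N → u ≢ v → suc (colour₀ u v) ≡ suc (colour₀ v u)
    symmetric {u} {v} _ _ u≢v with u ≟ N | v ≟ N
    ... | yes refl | yes refl = ⊥-elim (u≢v refl)
    ... | yes refl | no v≢N = cong suc (trans (colour₀-extra v)
                                (sym (trans (colour₀-row N v≢N) (cong (table v) (partner-extra v)))))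
    ... | no u≢N | yes refl = cong suc (trans (trans (colour₀-row N u≢N) (cong (table u) (partner-extra u)))
                                (sym (colour₀-extra u)))
    ... | no u≢N | no v≢N = cong suc (begin
      colour₀ u v              ≡⟨ colour₀-row v u≢N ⟩
      table u (partner u v)    ≡⟨ cong (table u) (partner-other u v≢N) ⟩
      table u v                ≡⟨ table-sym u v ⟩
      table v u                ≡⟨ cong (table v) (partner-other v u≢N) ⟨
      table v (partner v u)    ≡⟨ colour₀-row u v≢N ⟨
      colour₀ v u              ∎)
      where open ≡-Reasoning

    start₀≤e : ∀ u → start₀ u ≤ e
    start₀≤e u with u ≟ N
    ... | yes refl = subst (_≤ e) (sym start₀-extra) z≤n
    ... | no u≢N   = subst (_≤ e) (sym (start₀-row u≢N)) (offset≤e u)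

    window-top : ∀ {u} → u < suc N → suc (start₀ u) + d ≤ T
    window-top {u} _ = s≤s (subst (_≤ d + e) (+-comm d (start₀ u)) (+-monoʳ-≤ d (start₀≤e u)))

    -- The extra vertex sees the diagonal, the others a row of the table.
    window : ∀ {u v} → u < suc N → v < suc N → u ≢ v →
             suc (start₀ u) ≤ suc (colour₀ u v) × suc (colour₀ u v) ≤ suc (start₀ u) + d
    window {u} {v} u< v< u≢v with u ≟ N
    ... | yes refl rewrite start₀-extra | colour₀-extra v =
      s≤s z≤n , s≤s (diag-below (below-extra v< (λ v≡N → u≢v (sym v≡N))))
    ... | no u≢N rewrite start₀-row u≢N | colour₀-row v u≢N
      with Row.row-window u (below-extra u< u≢N) (partner< (below-extra u< u≢N) v<)
    ...   | lo , hi = s≤s lo , s≤s (≤-pred (subst (table u (partner u v) <_) (+-suc (offset u) d) hi))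

    injective : ∀ {u v v'} → u < suc N → v < suc N → v' < suc N → u ≢ v → u ≢ v' →
                suc (colour₀ u v) ≡ suc (colour₀ u v') → v ≡ v'
    injective {u} {v} {v'} u< v< v'< u≢v u≢v' eq with u ≟ N
    ... | yes refl = diag-injective (trans (sym (colour₀-extra v)) (trans (suc-injective eq) (colour₀-extra v')))
    ... | no u≢N = partner-injective u≢v u≢v'
      (Row.row-injective u u<N (partner< u<N v<) (partner< u<N v'<)
        (trans (sym (colour₀-row v u≢N)) (trans (suc-injective eq) (colour₀-row v' u≢N))))
      where u<N = below-extra u< u≢N

    -- In row u, column u stands for the extra vertex N.
    onto : ∀ {u x} → u < suc N → suc (start₀ u) ≤ x → x ≤ suc (start₀ u) + d →
           Σ ℕ λ v → v < suc N × u ≢ v × suc (colour₀ u v) ≡ x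
    onto {u} {suc x} u< (s≤s lo) (s≤s hi) with u ≟ N
    ... | yes refl with diag-onto {x} (subst (λ z → x ≤ z + d) start₀-extra hi)
    ...   | i , i<N , refl = i , ≤-trans i<N (n≤1+n N) , (λ N≡i → <⇒≢ i<N (sym N≡i)) , cong suc (colour₀-extra i)
    onto {u} {suc x} u< (s≤s lo) (s≤s hi) | no u≢N
      with Row.row-onto u u<N (subst (_≤ x) (start₀-row u≢N) lo)
                              (subst (suc x ≤_) (sym (+-suc (offset u) d)) (s≤s (subst (λ z → x ≤ z + d) (start₀-row u≢N) hi)))
      where u<N = below-extra u< u≢N
    ... | b , b<N , refl with b ≟ u
    ...   | yes refl = N , ≤-refl , u≢N , cong suc (trans (colour₀-row N u≢N) (cong (table b) (partner-extra b)))
    ...   | no b≢u  = b , ≤-trans b<N (n≤1+n N) , (λ u≡b → b≢u (sym u≡b)) ,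
                      cong suc (trans (colour₀-row b u≢N) (cong (table u) (partner-other u (<⇒≢ b<N))))

    -- Colours 1,…,d+1 occur at the extra vertex, the others at vertex M',
    -- whose window is [e + 1, e + d + 1].
    all-used : ∀ {x} → 1 ≤ x → x ≤ T → Σ ℕ λ u → Σ ℕ λ v → u < suc N × v < suc N × u ≢ v × suc (colour₀ u v) ≡ x
    all-used {suc x} _ (s≤s x≤d+e) with x ≤? d
    ... | yes x≤d with onto {N} {suc x} ≤-refl (s≤s (subst (_≤ x) (sym start₀-extra) z≤n))
                                              (s≤s (subst (λ z → x ≤ z + d) (sym start₀-extra) x≤d))
    ...   | v , v< , N≢v , eq = N , v , ≤-refl , v< , N≢v , eq
    all-used {suc x} _ (s≤s x≤d+e) | no x≰d
      with onto {M'} {suc x} M'<1+N (s≤s (subst (_≤ x) (sym start-M') e≤x))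
                                   (s≤s (subst (λ z → x ≤ z + d) (sym start-M') (subst (x ≤_) (+-comm d e) x≤d+e)))
      where
      M'<1+N : M' < suc N
      M'<1+N = s≤s (≤-trans (m≤m+n M' M') (n≤1+n _))
      start-M' : start₀ M' ≡ e
      start-M' = trans (start₀-row (<⇒≢ (s≤s (m≤m+n M' M')))) offset-M'
      e≤x : e ≤ x
      e≤x = ≤-trans (≤-trans (m≤n+m e a) (m≤m+n M' M')) (<⇒≤ (≰⇒> x≰d))
    ... | v , v< , M'≢v , eq = M' , v , s≤s (≤-trans (m≤m+n M' M') (n≤1+n _)) , v< , M'≢v , eq

-- The cyclic construction covers 2M - 1 ≤ T ≤ 3M - 2 for K_{2M}, M = M' + 1:
-- take e = T - (2M - 1) ≤ M' and a = M' - e.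
cyclic-range : ∀ M' {T} → suc (M' + M') ≤ T → T ≤ suc (M' + M' + M') → CompleteColouring (M' + M') T
cyclic-range M' {T} lo hi with ≤⇒∃+ lo
... | e , refl = CompleteColouring-cong (cong (λ x → x + x) a+e≡M') T≡ (Cyclic.colouring (M' ∸ e) e)
  where
  e≤M' : e ≤ M'
  e≤M' = +-cancelˡ-≤ (M' + M') e M' (≤-pred hi)
  a+e≡M' : M' ∸ e + e ≡ M'
  a+e≡M' = m∸n+n≡m e≤M'
  T≡ : suc (M' ∸ e + e + (M' ∸ e + e) + e) ≡ suc (M' + M' + e)
  T≡ = cong (λ x → suc (x + x + e)) a+e≡M'

doubling-step : ∀ M₀' {T₀} → CompleteColouring (M₀' + M₀') T₀ →
                let M' = M₀' + suc M₀' in CompleteColouring (M' + M') (suc (M' + M') + T₀)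
doubling-step M₀' {T₀} K =
  CompleteColouring-cong d≡ (trans (cong (λ x → T₀ + suc x) d≡) (+-comm T₀ _)) (Doubling.doubled K)
  where
  regroup : ∀ x → x + x + suc (suc (x + x)) ≡ x + suc x + (x + suc x)
  regroup = solve-∀
  d≡ = regroup M₀'

oddPow : ℕ → ℕ → ℕ
oddPow p q = (2 * p + 1) * 2 ^ q

oddPow-suc : ∀ p q → oddPow p (suc q) ≡ oddPow p q + oddPow p q
oddPow-suc p q = double (2 * p + 1) (2 ^ q)
  where
  double : ∀ P X → P * (2 * X) ≡ P * X + P * X
  double = solve-∀

oddPow-pos : ∀ p q → 1 ≤ oddPow p q
oddPow-pos p q = *-mono-≤ (m≤n+m 1 (2 * p)) (m^n>0 2 q)

-- For q = 0 the upper end of the range is 3M - 2, covered by the cyclic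
-- construction.
base-bound : ∀ p {M' T} → suc M' ≡ oddPow p 0 → T + (2 * p + 0 + 3) ≤ 4 * suc M' → T ≤ suc (M' + M' + M')
base-bound p {M'} {T} M≡ hi with suc-injective (trans M≡ (odd p))
  where
  odd : ∀ p → (2 * p + 1) * 1 ≡ suc (p + p)
  odd = solve-∀
... | refl = +-cancelʳ-≤ (2 * p + 0 + 3) T _ (subst (T + (2 * p + 0 + 3) ≤_) (split p) hi)
  where
  split : ∀ p → 4 * suc (p + p) ≡ suc (p + p + (p + p) + (p + p)) + (2 * p + 0 + 3)
  split = solve-∀

-- Beyond 3M - 2 the colour count of K_{2M}, M = 2M₀, is T₀ + 4M₀ - 1 with
-- T₀ in the range for K_{2M₀}.
step-range : ∀ p q M₀' T₀ → let M' = M₀' + suc M₀' in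
             ¬ suc (M' + M') + T₀ ≤ suc (M' + M' + M') →
             suc (M' + M') + T₀ + (2 * p + suc q + 3) ≤ 4 * suc M' →
             suc (M₀' + M₀') ≤ T₀ × T₀ + (2 * p + q + 3) ≤ 4 * suc M₀'
step-range p q M₀' T₀ big hi = lo₀ , hi₀
  where
  M' = M₀' + suc M₀'
  lo₀ : suc (M₀' + M₀') ≤ T₀
  lo₀ = ≤-trans (s≤s (+-monoʳ-≤ M₀' (n≤1+n M₀')))
          (+-cancelˡ-≤ (suc (M' + M')) (suc M') T₀ (subst (_≤ suc (M' + M') + T₀) (reorder M') (≰⇒> big)))
    where
    reorder : ∀ M' → suc (suc (M' + M' + M')) ≡ suc (M' + M') + suc M'
    reorder = solve-∀
  hi₀ : T₀ + (2 * p + q + 3) ≤ 4 * suc M₀'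
  hi₀ = +-cancelʳ-≤ (4 * suc M₀') _ _ (subst₂ _≤_ (lhs p q M₀' T₀) (rhs M₀') hi)
    where
    lhs : ∀ p q M₀' T₀ → suc (M₀' + suc M₀' + (M₀' + suc M₀')) + T₀ + (2 * p + suc q + 3)
                       ≡ T₀ + (2 * p + q + 3) + 4 * suc M₀'
    lhs = solve-∀
    rhs : ∀ M₀' → 4 * suc (M₀' + suc M₀') ≡ 4 * suc M₀' + 4 * suc M₀'
    rhs = solve-∀

-- K_{2M}, M = M' + 1 = (2p+1)·2^q, has an interval T-colouring for every
-- 2M - 1 ≤ T ≤ 4M - 2p - q - 3: by the cyclic construction up to 3M - 2 and
-- by doubling K_M (q ≥ 1) above.
complete-colourings : ∀ p q {M' T} → suc M' ≡ oddPow p q → suc (M' + M') ≤ T →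
                      T + (2 * p + q + 3) ≤ 4 * suc M' → CompleteColouring (M' + M') T
complete-colourings p q {M'} {T} M≡ lo hi with T ≤? suc (M' + M' + M')
... | yes T≤3M-2 = cyclic-range M' lo T≤3M-2
complete-colourings p zero    M≡ lo hi | no T≰3M-2 = ⊥-elim (T≰3M-2 (base-bound p M≡ hi))
complete-colourings p (suc q) {M'} M≡ lo hi | no T≰3M-2
  with ≥1⇒suc (oddPow-pos p q) | ≤⇒∃+ lo
... | M₀' , M₀≡ | T₀ , refl with half-order M₀≡
  where
  half-order : ∀ {M₀'} → oddPow p q ≡ suc M₀' → M' ≡ M₀' + suc M₀'
  half-order M₀≡ = suc-injective (trans M≡ (trans (oddPow-suc p q) (cong (λ x → x + x) M₀≡)))
... | refl with step-range p q M₀' T₀ T≰3M-2 hi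
... | lo₀ , hi₀ = doubling-step M₀' (complete-colourings p q (sym M₀≡) lo₀ hi₀)

div-mod : ∀ t n .{{_ : NonZero n}} → n * (t / n) + t % n ≡ t
div-mod t n = sym (trans (m≡m%n+[m/n]*n t n) (trans (+-comm (t % n) _) (cong (_+ t % n) (*-comm (t / n) n))))

quotient-range : ∀ n t k X .{{_ : NonZero n}} → (k ∸ 1) * n ≤ t → suc t ≤ X * n → k ∸ 1 ≤ t / n × suc (t / n) ≤ X
quotient-range n t k X lo hi = subst (_≤ t / n) (m*n/n≡m (k ∸ 1) n) (/-monoˡ-≤ n lo) , m<n*o⇒m/o<n hi

positive-∸ : ∀ {x y c} → 1 ≤ x → x ≤ y ∸ c → x + c ≤ y
positive-∸ {x} {y} {c} 1≤x x≤y∸c with c ≤? y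
... | yes c≤y = m≤o∸n⇒m+n≤o x c≤y x≤y∸c
... | no c≰y = ⊥-elim (<⇒≱ 1≤x (subst (x ≤_) (m≤n⇒m∸n≡0 (<⇒≤ (≰⇒> c≰y))) x≤y∸c))

order≡ : ∀ p q M' → suc M' ≡ oddPow p q → suc (suc (M' + M')) ≡ oddPow p (suc q)
order≡ p q M' M≡ = sym (trans (oddPow-suc p q) (trans (cong (λ x → x + x) (sym M≡)) (cong suc (+-suc M' M'))))

order-range : ∀ p q M' T → suc M' ≡ oddPow p q → let k = oddPow p (suc q) in
              k ∸ 1 ≤ T → suc T ≤ 2 * k ∸ (2 * p + 1) ∸ suc q →
              suc (M' + M') ≤ T × T + (2 * p + q + 3) ≤ 4 * suc M'
order-range p q M' T M≡ lo hi rewrite sym (order≡ p q M' M≡) =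
  lo , subst₂ _≤_ (lhs T p q) (rhs M') (positive-∸ (s≤s z≤n) (positive-∸ (s≤s z≤n) hi))
  where
  lhs : ∀ T p q → suc T + suc q + (2 * p + 1) ≡ T + (2 * p + q + 3)
  lhs = solve-∀
  rhs : ∀ M' → 2 * suc (suc (M' + M')) ≡ 4 * suc M'
  rhs = solve-∀

-- The corollary: write t = nT + s with s < n, colour K_k with T colours and
-- blow it up.
corollary3 : (n p q t : ℕ) → 1 ≤ n → 1 ≤ q →
    let k = (2 * p + 1) * 2 ^ q in
    (k ∸ 1) * n ≤ t → suc t ≤ (2 * k ∸ (2 * p + 1) ∸ q) * n →
    HasIntervalColoring (completeBalancedMultipartite k n) t
corollary3 n@(suc _) p (suc q) t _ _ lo hi
  with ≥1⇒suc (oddPow-pos p q) | quotient-range n t (oddPow p (suc q)) _ lo hi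
... | M' , M≡ | T-lo , T-hi with order-range p q M' (t / n) (sym M≡) T-lo T-hi
... | lo' , hi' =
  subst₂ (λ k t → HasIntervalColoring (completeBalancedMultipartite k n) t) (order≡ p q M' (sym M≡)) (div-mod t n)
    (BlowUp.colouring (complete-colourings p q (sym M≡) lo' hi') n (t % n) (s≤s z≤n) (m%n<n t n))
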